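{- Every logic $L$ with $\mathsf{BD}\le L\le\mathsf{CL}$ lies in exactly one of the intervals $[\mathsf{BD},\mathsf{K}^-]$ and $[\mathsf{KO},\mathsf{CL}]$.
   Context: Formulas are built from a countably infinite set of variables using $\wedge,\vee$, ${\sim}$, $\top,\bot$. A logic is a set of rules $\Gamma\vdash\varphi$ closed under reflexivity, monotonicity, cut and substitution; $\le$ is inclusion and $[L_1,L_2]=\{L:L_1\le L\le L_2\}$. For a matrix, a rule is valid if every valuation sending the premises into the designated set sends the conclusion there; $\mathrm{Log}$ is the set of valid rules. Let $\mathbf{DM}_4$ be the De Morgan algebra on $\{\bot,n,b,\top\}$ with $\bot<n,b<\top$ ($n,b$ incomparable), ${\sim}$ swapping $\top,\bot$ and fixing $n,b$. $\mathsf{BD}=\mathrm{Log}\langle\mathbf{DM}_4,\{b,\top\}\rangle$, $\mathsf{K}=\mathrm{Log}\langle\{\bot,n,\top\},\{\top\}\rangle$, $\mathsf{LP}=\mathrm{Log}\langle\{\bot,b,\top\},\{b,\top\}\rangle$, $\mathsf{CL}=\mathrm{Log}\langle\{\bot,\top\},\{\top\}\rangle$, $\mathsf{KO}=\mathsf{LP}\cap\mathsf{K}$. $\mathsf{K}^-$ is $\mathrm{Log}$ of the matrix: let $P=\{u,v,u',v'\}$ be the poset whose only strict order relations are $u<u'$, $u<v'$, $v<u'$, with involution $\partial$ swapping $u\leftrightarrow u'$, $v\leftrightarrow v'$; the algebra consists of the upsets of $P$ with $\cap,\cup$, $\bot=\emptyset$, $\top=P$, ${\sim}U=P\setminus\partial[U]$,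 and designated set $\{P\}$. -}

module Defs where

open import Data.Nat using (ℕ)
open import Data.Bool using (Bool; true; false; _∧_; _∨_; not)
open import Data.Product using (Σ; _×_; _,_)
open import Data.Sum using (_⊎_)
open import Data.Unit using (⊤)
open import Relation.Binary.PropositionalEquality using (_≡_; refl)

infixr 6 _∧ᶠ_
infixr 5 _∨ᶠ_

data Fm : Set where
  var  : ℕ → Fm
  _∧ᶠ_ : Fm → Fm → Fm
  _∨ᶠ_ : Fm → Fm → Fm
  ∼ᶠ_  : Fm → Fm
  ⊤ᶠ   : Fm
  ⊥ᶠ   : Fm

sub : (ℕ → Fm) → Fm → Fm
sub σ (var i)  = σ i
sub σ (φ ∧ᶠ ψ) = sub σ φ ∧ᶠ sub σ ψ
sub σ (φ ∨ᶠ ψ) = sub σ φ ∨ᶠ sub σ ψ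
sub σ (∼ᶠ φ)   = ∼ᶠ sub σ φ
sub σ ⊤ᶠ       = ⊤ᶠ
sub σ ⊥ᶠ       = ⊥ᶠ

FmSet : Set₁
FmSet = Fm → Set

_⊆_ : FmSet → FmSet → Set
Γ ⊆ Δ = ∀ φ → Γ φ → Δ φ

_∪_ : FmSet → FmSet → FmSet
(Γ ∪ Δ) φ = Γ φ ⊎ Δ φ

_[_] : (ℕ → Fm) → FmSet → FmSet
(σ [ Γ ]) ψ = Σ Fm (λ χ → Γ χ × (sub σ χ ≡ ψ))

-- A set of rules: L Γ φ means "the rule Γ ⊢ φ belongs to L".
RuleSet : Set₁
RuleSet = FmSet → Fm → Set

record IsLogic (L : RuleSet) : Set₁ where
  field
    reflexivity  : ∀ {Γ φ} → Γ φ → L Γ φ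
    monotonicity : ∀ {Γ Δ φ} → Γ ⊆ Δ → L Γ φ → L Δ φ
    cut          : ∀ {Γ Δ φ} → (∀ ψ → Δ ψ → L Γ ψ) → L (Γ ∪ Δ) φ → L Γ φ
    substitution : ∀ {Γ φ} (σ : ℕ → Fm) → L Γ φ → L (σ [ Γ ]) (sub σ φ)

_≤L_ : RuleSet → RuleSet → Set₁
L₁ ≤L L₂ = ∀ Γ φ → L₁ Γ φ → L₂ Γ φ

_∩L_ : RuleSet → RuleSet → RuleSet
(L₁ ∩L L₂) Γ φ = L₁ Γ φ × L₂ Γ φ

InInterval : RuleSet → RuleSet → RuleSet → Set₁
InInterval L₁ L₂ L = (L₁ ≤L L) × (L ≤L L₂)

record Matrix : Set₁ where
  field
    Carrier : Set
    meet    : Carrier → Carrier → Carrier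
    join    : Carrier → Carrier → Carrier
    neg     : Carrier → Carrier
    top     : Carrier
    bot     : Carrier
    D       : Carrier → Set

module _ (M : Matrix) where
  open Matrix M

  eval : (ℕ → Carrier) → Fm → Carrier
  eval v (var i)  = v i
  eval v (φ ∧ᶠ ψ) = meet (eval v φ) (eval v ψ)
  eval v (φ ∨ᶠ ψ) = join (eval v φ) (eval v ψ)
  eval v (∼ᶠ φ)   = neg (eval v φ)
  eval v ⊤ᶠ       = top
  eval v ⊥ᶠ       = bot

  -- Logic of the submatrix of M on a subset S closed under the
  -- operations (designated set D ∩ S): valuations take values in S.
  LogOn : (Carrier → Set) → RuleSet
  LogOn S Γ φ = (v : ℕ → Carrier) → (∀ i → S (v i)) →
                (∀ ψ → Γ ψ → D (eval v ψ)) → D (eval v φ)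

  Log : RuleSet
  Log = LogOn (λ _ → ⊤)

data DM4 : Set where
  ⊥₄ n₄ b₄ ⊤₄ : DM4

meet₄ : DM4 → DM4 → DM4
meet₄ ⊥₄ y  = ⊥₄
meet₄ ⊤₄ y  = y
meet₄ n₄ ⊥₄ = ⊥₄
meet₄ n₄ n₄ = n₄
meet₄ n₄ b₄ = ⊥₄
meet₄ n₄ ⊤₄ = n₄
meet₄ b₄ ⊥₄ = ⊥₄
meet₄ b₄ n₄ = ⊥₄
meet₄ b₄ b₄ = b₄
meet₄ b₄ ⊤₄ = b₄

join₄ : DM4 → DM4 → DM4
join₄ ⊤₄ y  = ⊤₄
join₄ ⊥₄ y  = y
join₄ n₄ ⊥₄ = n₄
join₄ n₄ n₄ = n₄
join₄ n₄ b₄ = ⊤₄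
join₄ n₄ ⊤₄ = ⊤₄
join₄ b₄ ⊥₄ = b₄
join₄ b₄ n₄ = ⊤₄
join₄ b₄ b₄ = b₄
join₄ b₄ ⊤₄ = ⊤₄

neg₄ : DM4 → DM4
neg₄ ⊥₄ = ⊤₄
neg₄ n₄ = n₄
neg₄ b₄ = b₄
neg₄ ⊤₄ = ⊥₄

Des₄ : DM4 → Set
Des₄ x = (x ≡ b₄) ⊎ (x ≡ ⊤₄)

DM4-matrix : Matrix
DM4-matrix = record
  { Carrier = DM4 ; meet = meet₄ ; join = join₄ ; neg = neg₄
  ; top = ⊤₄ ; bot = ⊥₄ ; D = Des₄ }

InK : DM4 → Set
InK x = (x ≡ ⊥₄) ⊎ (x ≡ n₄) ⊎ (x ≡ ⊤₄)

InLP : DM4 → Set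
InLP x = (x ≡ ⊥₄) ⊎ (x ≡ b₄) ⊎ (x ≡ ⊤₄)

InCL : DM4 → Set
InCL x = (x ≡ ⊥₄) ⊎ (x ≡ ⊤₄)

BD : RuleSet
BD = Log DM4-matrix

-- K = Log ⟨{⊥,n,⊤}, {⊤}⟩  (= {b,⊤} ∩ {⊥,n,⊤})
K : RuleSet
K = LogOn DM4-matrix InK

LP : RuleSet
LP = LogOn DM4-matrix InLP

-- CL = Log ⟨{⊥,⊤}, {⊤}⟩  (= {b,⊤} ∩ {⊥,⊤})
CL : RuleSet
CL = LogOn DM4-matrix InCL

KO : RuleSet
KO = LP ∩L K

data P : Set where
  u v u' v' : P

data _≤P_ : P → P → Set where
  ≤P-refl : ∀ {x} → x ≤P x
  u≤u'    : u ≤P u'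
  u≤v'    : u ≤P v'
  v≤u'    : v ≤P u'

∂ : P → P
∂ u  = u'
∂ u' = u
∂ v  = v'
∂ v' = v

record Upset : Set where
  field
    mem : P → Bool
    up  : ∀ {x y} → x ≤P y → mem x ≡ true → mem y ≡ true
open Upset

private
  ∧-up : ∀ {a a' b b'} → (a ≡ true → a' ≡ true) → (b ≡ true → b' ≡ true) →
         a ∧ b ≡ true → a' ∧ b' ≡ true
  ∧-up {true} {true} {true} f g h = g h
  ∧-up {true} {false} {true} f g h = f refl
  ∧-up {false} f g ()
  ∧-up {true} {_} {false} f g ()

  ∨-up : ∀ {a a' b b'} → (a ≡ true → a' ≡ true) → (b ≡ true → b' ≡ true) →
         a ∨ b ≡ true → a' ∨ b' ≡ true
  ∨-up {true} {true} f g h = refl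
  ∨-up {true} {false} f g h with f refl
  ... | ()
  ∨-up {false} {a'} {true} {true} f g h = Data.Bool.Properties.∨-zeroʳ a'
    where import Data.Bool.Properties
  ∨-up {false} {a'} {true} {false} f g h with g refl
  ... | ()
  ∨-up {false} {_} {false} f g ()

  contra : ∀ {a b : Bool} → (a ≡ true → b ≡ true) → not b ≡ true → not a ≡ true
  contra {false} f h = refl
  contra {true} {true} f ()
  contra {true} {false} f h with f refl
  ... | ()

  ∂-anti : ∀ {x y} → x ≤P y → ∂ y ≤P ∂ x
  ∂-anti ≤P-refl = ≤P-refl
  ∂-anti u≤u' = u≤u'
  ∂-anti u≤v' = v≤u'
  ∂-anti v≤u' = u≤v'

_⊓_ : Upset → Upset → Upset
U ⊓ V = record { mem = λ x → mem U x ∧ mem V x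
               ; up = λ p → ∧-up (up U p) (up V p) }

_⊔_ : Upset → Upset → Upset
U ⊔ V = record { mem = λ x → mem U x ∨ mem V x
               ; up = λ p → ∨-up (up U p) (up V p) }

-- ∼U = P ∖ ∂[U]; since ∂ is an involution, x ∈ ∂[U] iff ∂ x ∈ U.
∼ᵘ : Upset → Upset
∼ᵘ U = record { mem = λ x → not (mem U (∂ x))
              ; up = λ p → contra (up U (∂-anti p)) }

Pᵘ : Upset
Pᵘ = record { mem = λ _ → true ; up = λ _ _ → refl }

∅ᵘ : Upset
∅ᵘ = record { mem = λ _ → false ; up = λ _ () }

IsWhole : Upset → Set
IsWhole U = ∀ x → mem U x ≡ true

K⁻-matrix : Matrix
K⁻-matrix = record
  { Carrier = Upset ; meet = _⊓_ ; join = _⊔_ ; neg = ∼ᵘ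
  ; top = Pᵘ ; bot = ∅ᵘ ; D = IsWhole }

K⁻ : RuleSet
K⁻ = Log K⁻-matrix

-- The dividing line is the Kleene rule (p ∧ ∼p) ∨ q ⊢ (r ∨ ∼r) ∨ q: it is valid in KO but not
-- in K⁻, so no logic lies in both intervals.
--
-- If L has the Kleene rule, then KO ≤ L. An LP-valid rule Δ ⊢ ψ becomes BD-valid once the
-- excluded middles (pᵢ ∨ ∼pᵢ) ∨ ψ are added as premises, and each of these follows from Δ in L:
-- by compactness of K, the K-valid rule Δ ⊢ ψ is BD-valid up to a finite disjunction of
-- contradictions pᵢ ∧ ∼pᵢ, which instances of the Kleene rule trade for excluded middles.
--
-- If L lacks the Kleene rule, then L ≤ K⁻. A rule Γ ⊢ φ of L refuted in K⁻ by a valuation h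
-- leaves the point u or the point v of P out of the value of φ. Evaluating upsets at a point y
-- is a homomorphism πᵧ into DM₄. A substitution τ read off from the values of h lies above
-- πᵤ ∘ h or πᵥ ∘ h in the knowledge order at every valuation satisfying the Kleene premise, so
-- τ[Γ] holds there, and coincides with πᵧ ∘ h wherever the Kleene conclusion fails as well, so
-- τφ fails there. Hence the Kleene rule follows from Γ ⊢ φ over BD.

module Submission where

open import Defs
open import Level using (0ℓ; Lift; lift; lower) renaming (_⊔_ to _⊔ℓ_)
open import Axiom.ExcludedMiddle using (ExcludedMiddle)
open import Axiom.DoubleNegationElimination using (em⇒dne)
open import Data.Bool using (Bool; true; false; _∧_; _∨_; not)
  renaming (_≤_ to _≤ᵇ_)
open Data.Bool using (b≤b; f≤t)
open import Data.Bool.Properties using (not-involutive)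
  renaming (_≟_ to _≟ᵇ_; _≤?_ to _≤ᵇ?_)
open import Data.Empty using (⊥-elim)
open import Data.Nat using (ℕ; zero; suc; _<_; _≤_; s≤s; s≤s⁻¹; _≟_) renaming (_⊔_ to _⊔ℕ_)
open import Data.Nat.Properties
  using (≤-refl; _≤?_; <-≤-trans; <-irrefl; ≤∧≢⇒<; m<1+n⇒m<n∨m≡n; m≤m⊔n; m≤n⊔m; m≤n⇒m≤o⊔n)
open import Data.Product using (∃; _×_; _,_; proj₁; proj₂)
open import Data.Sum using (_⊎_; inj₁; inj₂)
open import Data.Unit using (tt)
open import Function using (_∘_; case_of_)
open import Relation.Unary using (｛_｝)
open import Relation.Nullary using (¬_; ¬?; Dec; yes; no)
open import Relation.Nullary.Decidable
  using (map′; toWitness; _×-dec_; _⊎-dec_; _→-dec_)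
open import Relation.Binary.PropositionalEquality
  using (_≡_; _≢_; refl; sym; trans; cong; cong₂; subst; subst₂; module ≡-Reasoning)
open Upset

lowerExcludedMiddle : ∀ {a} b → ExcludedMiddle (a ⊔ℓ b) → ExcludedMiddle a
lowerExcludedMiddle b em = map′ lower lift (em {Lift b _})

module _ {a} (em : ExcludedMiddle a) where

  private
    dne = em⇒dne em

  ¬∀⇒∃¬ : {A : Set a} {B : A → Set a} → ¬ (∀ x → B x) → ∃ λ x → ¬ B x
  ¬∀⇒∃¬ ¬∀ = dne λ ¬∃ → ¬∀ λ x → dne λ ¬Bx → ¬∃ (x , ¬Bx)

  ¬→⇒×¬ : {A B : Set a} → ¬ (A → B) → A × ¬ B
  ¬→⇒×¬ ¬A→B = dne (λ ¬A → ¬A→B (⊥-elim ∘ ¬A)) , λ b → ¬A→B λ _ → b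

⟨_,_⟩ : Bool → Bool → DM4
⟨ true  , false ⟩ = ⊤₄
⟨ false , true  ⟩ = ⊥₄
⟨ true  , true  ⟩ = b₄
⟨ false , false ⟩ = n₄

truth falsity : DM4 → Bool
truth ⊥₄ = false
truth n₄ = false
truth b₄ = true
truth ⊤₄ = true
falsity ⊥₄ = true
falsity n₄ = false
falsity b₄ = true
falsity ⊤₄ = false

⟨truth,falsity⟩ : ∀ x → ⟨ truth x , falsity x ⟩ ≡ x
⟨truth,falsity⟩ ⊥₄ = refl
⟨truth,falsity⟩ n₄ = refl
⟨truth,falsity⟩ b₄ = refl
⟨truth,falsity⟩ ⊤₄ = refl

_≟₄_ : (x y : DM4) → Dec (x ≡ y)
x ≟₄ y = map′ fromPair (λ { refl → refl , refl })
              (truth x ≟ᵇ truth y ×-dec falsity x ≟ᵇ falsity y)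
  where
  fromPair : truth x ≡ truth y × falsity x ≡ falsity y → x ≡ y
  fromPair (t , f) = trans (sym (⟨truth,falsity⟩ x))
                           (trans (cong₂ ⟨_,_⟩ t f) (⟨truth,falsity⟩ y))

Des? : ∀ x → Dec (Des₄ x)
Des? x = x ≟₄ b₄ ⊎-dec x ≟₄ ⊤₄

-- Facts about finitely many values in DM₄ or Bool are decided by evaluation: toWitness {a? = …} tt.
∀₄? : {P : DM4 → Set} → (∀ x → Dec (P x)) → Dec (∀ x → P x)
∀₄? P? = map′ (λ { (p , q , r , s) → λ { ⊥₄ → p ; n₄ → q ; b₄ → r ; ⊤₄ → s } })
              (λ all → all ⊥₄ , all n₄ , all b₄ , all ⊤₄)
              (P? ⊥₄ ×-dec P? n₄ ×-dec P? b₄ ×-dec P? ⊤₄)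

∀ᵇ? : {P : Bool → Set} → (∀ x → Dec (P x)) → Dec (∀ x → P x)
∀ᵇ? P? = map′ (λ { (p , q) → λ { false → p ; true → q } })
              (λ all → all false , all true)
              (P? false ×-dec P? true)

_≤ₖ_ : DM4 → DM4 → Set
x ≤ₖ y = truth x ≤ᵇ truth y × falsity x ≤ᵇ falsity y

_≤ₖ?_ : ∀ x y → Dec (x ≤ₖ y)
x ≤ₖ? y = truth x ≤ᵇ? truth y ×-dec falsity x ≤ᵇ? falsity y

≤ₖ-refl : ∀ x → x ≤ₖ x
≤ₖ-refl x = b≤b , b≤b

n≤ₖ : ∀ x → n₄ ≤ₖ x
n≤ₖ = toWitness {a? = ∀₄? λ x → n₄ ≤ₖ? x} tt

⟨⟩-neg : ∀ a b → ⟨ b , a ⟩ ≡ neg₄ ⟨ a , b ⟩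
⟨⟩-neg = toWitness {a? = ∀ᵇ? λ a → ∀ᵇ? λ b → ⟨ b , a ⟩ ≟₄ neg₄ ⟨ a , b ⟩} tt

meet-monoₖ : ∀ a a' b b' → a ≤ₖ a' → b ≤ₖ b' → meet₄ a b ≤ₖ meet₄ a' b'
meet-monoₖ = toWitness {a? = ∀₄? λ a → ∀₄? λ a' → ∀₄? λ b → ∀₄? λ b' →
                            a ≤ₖ? a' →-dec b ≤ₖ? b' →-dec meet₄ a b ≤ₖ? meet₄ a' b'} tt

join-monoₖ : ∀ a a' b b' → a ≤ₖ a' → b ≤ₖ b' → join₄ a b ≤ₖ join₄ a' b'
join-monoₖ = toWitness {a? = ∀₄? λ a → ∀₄? λ a' → ∀₄? λ b → ∀₄? λ b' →
                            a ≤ₖ? a' →-dec b ≤ₖ? b' →-dec join₄ a b ≤ₖ? join₄ a' b'} tt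

neg-monoₖ : ∀ a a' → a ≤ₖ a' → neg₄ a ≤ₖ neg₄ a'
neg-monoₖ = toWitness {a? = ∀₄? λ a → ∀₄? λ a' → a ≤ₖ? a' →-dec neg₄ a ≤ₖ? neg₄ a'} tt

⊤≤ₖ⇒designated : ∀ x → ⊤₄ ≤ₖ x → Des₄ x
⊤≤ₖ⇒designated = toWitness {a? = ∀₄? λ x → ⊤₄ ≤ₖ? x →-dec Des? x} tt

join-designated : ∀ x y → Des₄ (join₄ x y) → Des₄ x ⊎ Des₄ y
join-designated = toWitness {a? = ∀₄? λ x → ∀₄? λ y →
                                 Des? (join₄ x y) →-dec (Des? x ⊎-dec Des? y)} tt

designated-joinˡ : ∀ x y → Des₄ x → Des₄ (join₄ x y)
designated-joinˡ = toWitness {a? = ∀₄? λ x → ∀₄? λ y → Des? x →-dec Des? (join₄ x y)} tt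

designated-join-rotate : ∀ x y z → Des₄ (join₄ (join₄ x y) z) → Des₄ (join₄ y (join₄ x z))
designated-join-rotate = toWitness {a? = ∀₄? λ x → ∀₄? λ y → ∀₄? λ z →
                        Des? (join₄ (join₄ x y) z) →-dec Des? (join₄ y (join₄ x z))} tt

designated-join-swap : ∀ x y z → Des₄ (join₄ x (join₄ y z)) → Des₄ (join₄ y (join₄ x z))
designated-join-swap = toWitness {a? = ∀₄? λ x → ∀₄? λ y → ∀₄? λ z →
                      Des? (join₄ x (join₄ y z)) →-dec Des? (join₄ y (join₄ x z))} tt

designated-join-contract : ∀ x z → Des₄ (join₄ x (join₄ x z)) → Des₄ (join₄ x z)
designated-join-contract = toWitness {a? = ∀₄? λ x → ∀₄? λ z →
                          Des? (join₄ x (join₄ x z)) →-dec Des? (join₄ x z)} tt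

designated-joinʳ : ∀ x y → Des₄ y → Des₄ (join₄ x y)
designated-joinʳ = toWitness {a? = ∀₄? λ x → ∀₄? λ y → Des? y →-dec Des? (join₄ x y)} tt

support : Fm → ℕ
support (var i)  = suc i
support (φ ∧ᶠ ψ) = support φ ⊔ℕ support ψ
support (φ ∨ᶠ ψ) = support φ ⊔ℕ support ψ
support (∼ᶠ φ)   = support φ
support ⊤ᶠ       = 0
support ⊥ᶠ       = 0

module _ (M : Matrix) where
  open Matrix M

  eval-sub : ∀ w τ χ → eval M w (sub τ χ) ≡ eval M (eval M w ∘ τ) χ
  eval-sub w τ (var i)  = refl
  eval-sub w τ (φ ∧ᶠ ψ) = cong₂ meet (eval-sub w τ φ) (eval-sub w τ ψ)
  eval-sub w τ (φ ∨ᶠ ψ) = cong₂ join (eval-sub w τ φ) (eval-sub w τ ψ)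
  eval-sub w τ (∼ᶠ φ)   = cong neg (eval-sub w τ φ)
  eval-sub w τ ⊤ᶠ       = refl
  eval-sub w τ ⊥ᶠ       = refl

  eval-local : ∀ χ {w w'} → (∀ i → i < support χ → w i ≡ w' i) →
               eval M w χ ≡ eval M w' χ
  eval-local (var i)  w≈w' = w≈w' i ≤-refl
  eval-local (φ ∧ᶠ ψ) w≈w' = cong₂ meet
    (eval-local φ λ i i<φ → w≈w' i (<-≤-trans i<φ (m≤m⊔n (support φ) (support ψ))))
    (eval-local ψ λ i i<ψ → w≈w' i (<-≤-trans i<ψ (m≤n⊔m (support φ) (support ψ))))
  eval-local (φ ∨ᶠ ψ) w≈w' = cong₂ join
    (eval-local φ λ i i<φ → w≈w' i (<-≤-trans i<φ (m≤m⊔n (support φ) (support ψ))))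
    (eval-local ψ λ i i<ψ → w≈w' i (<-≤-trans i<ψ (m≤n⊔m (support φ) (support ψ))))
  eval-local (∼ᶠ φ)   w≈w' = cong neg (eval-local φ w≈w')
  eval-local ⊤ᶠ       w≈w' = refl
  eval-local ⊥ᶠ       w≈w' = refl

  eval-ext : ∀ χ {w w'} → (∀ i → w i ≡ w' i) → eval M w χ ≡ eval M w' χ
  eval-ext χ w≈w' = eval-local χ λ i _ → w≈w' i

evD : (ℕ → DM4) → Fm → DM4
evD = eval DM4-matrix

evK : (ℕ → Upset) → Fm → Upset
evK = eval K⁻-matrix

eval-monoₖ : ∀ {w w'} → (∀ i → w i ≤ₖ w' i) → ∀ χ → evD w χ ≤ₖ evD w' χ
eval-monoₖ w≤w' (var i)  = w≤w' i
eval-monoₖ w≤w' (φ ∧ᶠ ψ) = meet-monoₖ _ _ _ _ (eval-monoₖ w≤w' φ) (eval-monoₖ w≤w' ψ)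
eval-monoₖ w≤w' (φ ∨ᶠ ψ) = join-monoₖ _ _ _ _ (eval-monoₖ w≤w' φ) (eval-monoₖ w≤w' ψ)
eval-monoₖ w≤w' (∼ᶠ φ)   = neg-monoₖ _ _ (eval-monoₖ w≤w' φ)
eval-monoₖ w≤w' ⊤ᶠ       = ≤ₖ-refl ⊤₄
eval-monoₖ w≤w' ⊥ᶠ       = ≤ₖ-refl ⊥₄

π : P → Upset → DM4
π y U = ⟨ mem U y , not (mem U (∂ y)) ⟩

∂-involutive : ∀ y → ∂ (∂ y) ≡ y
∂-involutive u  = refl
∂-involutive v  = refl
∂-involutive u' = refl
∂-involutive v' = refl

π-⊓ : ∀ y U V → π y (U ⊓ V) ≡ meet₄ (π y U) (π y V)
π-⊓ y U V = law (mem U y) (mem U (∂ y)) (mem V y) (mem V (∂ y))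
  where
  law : ∀ a b c d → ⟨ a ∧ c , not (b ∧ d) ⟩ ≡ meet₄ ⟨ a , not b ⟩ ⟨ c , not d ⟩
  law = toWitness {a? = ∀ᵇ? λ a → ∀ᵇ? λ b → ∀ᵇ? λ c → ∀ᵇ? λ d →
                       ⟨ a ∧ c , not (b ∧ d) ⟩ ≟₄ meet₄ ⟨ a , not b ⟩ ⟨ c , not d ⟩} tt

π-⊔ : ∀ y U V → π y (U ⊔ V) ≡ join₄ (π y U) (π y V)
π-⊔ y U V = law (mem U y) (mem U (∂ y)) (mem V y) (mem V (∂ y))
  where
  law : ∀ a b c d → ⟨ a ∨ c , not (b ∨ d) ⟩ ≡ join₄ ⟨ a , not b ⟩ ⟨ c , not d ⟩
  law = toWitness {a? = ∀ᵇ? λ a → ∀ᵇ? λ b → ∀ᵇ? λ c → ∀ᵇ? λ d →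
                       ⟨ a ∨ c , not (b ∨ d) ⟩ ≟₄ join₄ ⟨ a , not b ⟩ ⟨ c , not d ⟩} tt

π-∼ : ∀ y U → π y (∼ᵘ U) ≡ neg₄ (π y U)
π-∼ y U = begin
  ⟨ not (mem U (∂ y)) , not (not (mem U (∂ (∂ y)))) ⟩
    ≡⟨ cong (λ b → ⟨ not (mem U (∂ y)) , b ⟩)
            (trans (not-involutive _) (cong (mem U) (∂-involutive y))) ⟩
  ⟨ not (mem U (∂ y)) , mem U y ⟩
    ≡⟨ ⟨⟩-neg (mem U y) (not (mem U (∂ y))) ⟩
  neg₄ (π y U) ∎
  where open ≡-Reasoning

π-eval : ∀ y h χ → π y (evK h χ) ≡ evD (π y ∘ h) χ
π-eval y h (var i)  = refl
π-eval y h (φ ∧ᶠ ψ) = trans (π-⊓ y (evK h φ) (evK h ψ)) (cong₂ meet₄ (π-eval y h φ) (π-eval y h ψ))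
π-eval y h (φ ∨ᶠ ψ) = trans (π-⊔ y (evK h φ) (evK h ψ)) (cong₂ join₄ (π-eval y h φ) (π-eval y h ψ))
π-eval y h (∼ᶠ φ)   = trans (π-∼ y (evK h φ)) (cong neg₄ (π-eval y h φ))
π-eval y h ⊤ᶠ       = refl
π-eval y h ⊥ᶠ       = refl

π-whole : ∀ y U → IsWhole U → π y U ≡ ⊤₄
π-whole y U whole rewrite whole y | whole (∂ y) = refl

π-undesignated : ∀ y U → mem U y ≡ false → ¬ Des₄ (π y U)
π-undesignated y U y∉U rewrite y∉U with mem U (∂ y)
... | true  = λ { (inj₁ ()) ; (inj₂ ()) }
... | false = λ { (inj₁ ()) ; (inj₂ ()) }

whole-from-u-v : ∀ U → mem U u ≡ true → mem U v ≡ true → IsWhole U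
whole-from-u-v U u∈U v∈U u  = u∈U
whole-from-u-v U u∈U v∈U v  = v∈U
whole-from-u-v U u∈U v∈U u' = up U u≤u' u∈U
whole-from-u-v U u∈U v∈U v' = up U u≤v' u∈U

module _ (y : P) (h : ℕ → Upset) (τ : ℕ → Fm) (e : ℕ → DM4) where

  whole⇒designated : (∀ i → π y (h i) ≤ₖ evD e (τ i)) →
                     ∀ γ → IsWhole (evK h γ) → Des₄ (evD e (sub τ γ))
  whole⇒designated π≤τ γ whole = ⊤≤ₖ⇒designated _ (subst₂ _≤ₖ_ πγ≡⊤ (sym (eval-sub DM4-matrix e τ γ))
                                   (eval-monoₖ π≤τ γ))
    where
    πγ≡⊤ : evD (π y ∘ h) γ ≡ ⊤₄
    πγ≡⊤ = trans (sym (π-eval y h γ)) (π-whole y (evK h γ) whole)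

  missing⇒undesignated : (∀ i → evD e (τ i) ≡ π y (h i)) →
                         ∀ φ → mem (evK h φ) y ≡ false → ¬ Des₄ (evD e (sub τ φ))
  missing⇒undesignated τ≡π φ y∉φ = subst (¬_ ∘ Des₄) (sym eq) (π-undesignated y (evK h φ) y∉φ)
    where
    eq : evD e (sub τ φ) ≡ π y (evK h φ)
    eq = begin
      evD e (sub τ φ)      ≡⟨ eval-sub DM4-matrix e τ φ ⟩
      evD (evD e ∘ τ) φ    ≡⟨ eval-ext DM4-matrix φ τ≡π ⟩
      evD (π y ∘ h) φ      ≡⟨ sym (π-eval y h φ) ⟩
      π y (evK h φ)        ∎
      where open ≡-Reasoning

p q r : Fm
p = var 0
q = var 1
r = var 2

kleenePremise kleeneConclusion : Fm
kleenePremise    = (p ∧ᶠ ∼ᶠ p) ∨ᶠ q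
kleeneConclusion = (r ∨ᶠ ∼ᶠ r) ∨ᶠ q

Kleene : RuleSet → Set
Kleene L = L ｛ kleenePremise ｝ kleeneConclusion

contradiction⇒≡b : ∀ x → Des₄ (meet₄ x (neg₄ x)) → x ≡ b₄
contradiction⇒≡b = toWitness {a? = ∀₄? λ x → Des? (meet₄ x (neg₄ x)) →-dec x ≟₄ b₄} tt

¬excludedMiddle⇒≡n : ∀ x → ¬ Des₄ (join₄ x (neg₄ x)) → x ≡ n₄
¬excludedMiddle⇒≡n = toWitness {a? = ∀₄? λ x → ¬? (Des? (join₄ x (neg₄ x))) →-dec x ≟₄ n₄} tt

excludedMiddle⇒≢n : ∀ x → Des₄ (join₄ x (neg₄ x)) → x ≢ n₄
excludedMiddle⇒≢n = toWitness {a? = ∀₄? λ x → Des? (join₄ x (neg₄ x)) →-dec ¬? (x ≟₄ n₄)} tt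

kleenePremise-designated : ∀ e → Des₄ (evD e kleenePremise) → e 0 ≡ b₄ ⊎ Des₄ (e 1)
kleenePremise-designated e d with join-designated _ (e 1) d
... | inj₁ glutty = inj₁ (contradiction⇒≡b (e 0) glutty)
... | inj₂ d₁     = inj₂ d₁

kleeneConclusion-designated : ∀ e → e 2 ≢ n₄ ⊎ Des₄ (e 1) → Des₄ (evD e kleeneConclusion)
kleeneConclusion-designated e (inj₁ r≢n) with Des? (join₄ (e 2) (neg₄ (e 2)))
... | yes d = designated-joinˡ _ (e 1) d
... | no ¬d = ⊥-elim (r≢n (¬excludedMiddle⇒≡n (e 2) ¬d))
kleeneConclusion-designated e (inj₂ d₁) = designated-joinʳ _ (e 1) d₁

-- Substitutions turning a K⁻-counterexample into the Kleene rule

⟪_,_,_⟫ : DM4 → DM4 → DM4 → ℕ → DM4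
⟪ x , y , z ⟫ zero          = x
⟪ x , y , z ⟫ (suc zero)    = y
⟪ x , y , z ⟫ (suc (suc _)) = z

eval-pqr : ∀ χ → support χ ≤ 3 → ∀ e → evD e χ ≡ evD ⟪ e 0 , e 1 , e 2 ⟫ χ
eval-pqr χ χ≤3 e = eval-local DM4-matrix χ λ i i<χ → agree i (<-≤-trans i<χ χ≤3)
  where
  agree : ∀ i → i < 3 → e i ≡ ⟪ e 0 , e 1 , e 2 ⟫ i
  agree zero                _ = refl
  agree (suc zero)          _ = refl
  agree (suc (suc zero))    _ = refl
  agree (suc (suc (suc _))) (s≤s (s≤s (s≤s ())))

-- The three generator relations u < u', u < v', v < u' of P.
UpsetPattern : Bool → Bool → Bool → Bool → Set
UpsetPattern a b a' b' = a ≤ᵇ a' × a ≤ᵇ b' × b ≤ᵇ a'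

UpsetPattern? : ∀ a b a' b' → Dec (UpsetPattern a b a' b')
UpsetPattern? a b a' b' = a ≤ᵇ? a' ×-dec a ≤ᵇ? b' ×-dec b ≤ᵇ? a'

upset-pattern : ∀ U → UpsetPattern (mem U u) (mem U v) (mem U u') (mem U v')
upset-pattern U = ≤ᵇ-from (up U u≤u') , ≤ᵇ-from (up U u≤v') , ≤ᵇ-from (up U v≤u')
  where
  ≤ᵇ-from : ∀ {a b} → (a ≡ true → b ≡ true) → a ≤ᵇ b
  ≤ᵇ-from {false} {false} _ = b≤b
  ≤ᵇ-from {false} {true}  _ = f≤t
  ≤ᵇ-from {true}  a⇒b rewrite a⇒b refl = b≤b

-- π u U is never b, so it is named by ⊤, r or ⊥, with r standing for n.
uTerm : Upset → Fm
uTerm U with mem U u | mem U u'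
... | true  | _     = ⊤ᶠ
... | false | true  = r
... | false | false = ⊥ᶠ

uTerm-aboveₖ : ∀ U e → π u U ≤ₖ evD e (uTerm U)
uTerm-aboveₖ U e with mem U u | mem U u' | up U u≤u'
... | true  | true  | _  = ≤ₖ-refl ⊤₄
... | true  | false | up = case up refl of λ ()
... | false | true  | _  = n≤ₖ (e 2)
... | false | false | _  = ≤ₖ-refl ⊥₄

uTerm-exact : ∀ U e → e 2 ≡ n₄ → evD e (uTerm U) ≡ π u U
uTerm-exact U e r=n with mem U u | mem U u' | up U u≤u'
... | true  | true  | _  = refl
... | true  | false | up = case up refl of λ ()
... | false | true  | _  = r=n
... | false | false | _  = refl

-- Under p = b, r = n and q ∈ {⊥, n} the term for U evaluates to π v U;
-- once q is designated it evaluates above π u U in the knowledge order.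
vTerm′ : Bool → Bool → Bool → Bool → Fm
vTerm′ false false false false = ⊥ᶠ
vTerm′ false false false true  = ∼ᶠ (q ∨ᶠ r)
vTerm′ false false true  false = p ∧ᶠ r
vTerm′ false false true  true  = r
vTerm′ false true  true  false = p
vTerm′ false true  true  true  = p ∨ᶠ r
vTerm′ true  false true  true  = q ∨ᶠ r
vTerm′ true  true  true  true  = ⊤ᶠ
vTerm′ _     _     _     _     = ⊥ᶠ

vTerm : Upset → Fm
vTerm U = vTerm′ (mem U u) (mem U v) (mem U u') (mem U v')

eval-vTerm : ∀ U e → evD e (vTerm U) ≡ evD ⟪ e 0 , e 1 , e 2 ⟫ (vTerm U)
eval-vTerm U = eval-pqr (vTerm U) (support≤3 (mem U u) (mem U v) (mem U u') (mem U v'))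
  where
  support≤3 : ∀ a b a' b' → support (vTerm′ a b a' b') ≤ 3
  support≤3 = toWitness {a? = ∀ᵇ? λ a → ∀ᵇ? λ b → ∀ᵇ? λ a' → ∀ᵇ? λ b' →
                             support (vTerm′ a b a' b') ≤? 3} tt

vTerm-aboveₖ-πv : ∀ U e → e 0 ≡ b₄ → π v U ≤ₖ evD e (vTerm U)
vTerm-aboveₖ-πv U e p=b rewrite eval-vTerm U e | p=b =
  law _ _ _ _ (upset-pattern U) (e 1) (e 2)
  where
  law : ∀ a b a' b' → UpsetPattern a b a' b' → ∀ y z →
        ⟨ b , not b' ⟩ ≤ₖ evD ⟪ b₄ , y , z ⟫ (vTerm′ a b a' b')
  law = toWitness {a? = ∀ᵇ? λ a → ∀ᵇ? λ b → ∀ᵇ? λ a' → ∀ᵇ? λ b' →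
          UpsetPattern? a b a' b' →-dec ∀₄? λ y → ∀₄? λ z →
          ⟨ b , not b' ⟩ ≤ₖ? evD ⟪ b₄ , y , z ⟫ (vTerm′ a b a' b')} tt

vTerm-aboveₖ-πu : ∀ U e → Des₄ (e 1) → π u U ≤ₖ evD e (vTerm U)
vTerm-aboveₖ-πu U e q∈D rewrite eval-vTerm U e =
  law _ _ _ _ (upset-pattern U) (e 0) (e 1) (e 2) q∈D
  where
  law : ∀ a b a' b' → UpsetPattern a b a' b' → ∀ x y z → Des₄ y →
        ⟨ a , not a' ⟩ ≤ₖ evD ⟪ x , y , z ⟫ (vTerm′ a b a' b')
  law = toWitness {a? = ∀ᵇ? λ a → ∀ᵇ? λ b → ∀ᵇ? λ a' → ∀ᵇ? λ b' →
          UpsetPattern? a b a' b' →-dec ∀₄? λ x → ∀₄? λ y → ∀₄? λ z → Des? y →-dec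
          ⟨ a , not a' ⟩ ≤ₖ? evD ⟪ x , y , z ⟫ (vTerm′ a b a' b')} tt

vTerm-exact : ∀ U e → e 0 ≡ b₄ → ¬ Des₄ (e 1) → e 2 ≡ n₄ → evD e (vTerm U) ≡ π v U
vTerm-exact U e p=b q∉D r=n rewrite eval-vTerm U e | p=b | r=n =
  law _ _ _ _ (upset-pattern U) (e 1) q∉D
  where
  law : ∀ a b a' b' → UpsetPattern a b a' b' → ∀ y → ¬ Des₄ y →
        evD ⟪ b₄ , y , n₄ ⟫ (vTerm′ a b a' b') ≡ ⟨ b , not b' ⟩
  law = toWitness {a? = ∀ᵇ? λ a → ∀ᵇ? λ b → ∀ᵇ? λ a' → ∀ᵇ? λ b' →
          UpsetPattern? a b a' b' →-dec ∀₄? λ y → ¬? (Des? y) →-dec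
          evD ⟪ b₄ , y , n₄ ⟫ (vTerm′ a b a' b') ≟₄ ⟨ b , not b' ⟩} tt

InK⇒≢b : ∀ {x} → InK x → x ≢ b₄
InK⇒≢b (inj₁ refl)        ()
InK⇒≢b (inj₂ (inj₁ refl)) ()
InK⇒≢b (inj₂ (inj₂ refl)) ()

≢b⇒InK : ∀ x → x ≢ b₄ → InK x
≢b⇒InK ⊥₄ _   = inj₁ refl
≢b⇒InK n₄ _   = inj₂ (inj₁ refl)
≢b⇒InK b₄ x≢b = ⊥-elim (x≢b refl)
≢b⇒InK ⊤₄ _   = inj₂ (inj₂ refl)

InLP⇒≢n : ∀ {x} → InLP x → x ≢ n₄
InLP⇒≢n (inj₁ refl)        ()
InLP⇒≢n (inj₂ (inj₁ refl)) ()
InLP⇒≢n (inj₂ (inj₂ refl)) ()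

≢n⇒InLP : ∀ x → x ≢ n₄ → InLP x
≢n⇒InLP ⊥₄ _   = inj₁ refl
≢n⇒InLP n₄ x≢n = ⊥-elim (x≢n refl)
≢n⇒InLP b₄ _   = inj₂ (inj₁ refl)
≢n⇒InLP ⊤₄ _   = inj₂ (inj₂ refl)

kleene∈KO : Kleene KO
kleene∈KO = (λ e inLP _ → kleeneConclusion-designated e (inj₁ (InLP⇒≢n (inLP 2))))
          , λ e inK designated → kleeneConclusion-designated e (inj₂ (q∈D e inK designated))
  where
  q∈D : ∀ e → (∀ i → InK (e i)) → (∀ χ → ｛ kleenePremise ｝ χ → Des₄ (evD e χ)) → Des₄ (e 1)
  q∈D e inK designated with kleenePremise-designated e (designated _ refl)
  ... | inj₁ p=b = ⊥-elim (InK⇒≢b (inK 0) p=b)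
  ... | inj₂ q∈D = q∈D

upset : ∀ a b a' b' → UpsetPattern a b a' b' → Upset
upset a b a' b' (a≤a' , a≤b' , b≤a') = record { mem = member ; up = monotone }
  where
  member : P → Bool
  member u  = a
  member v  = b
  member u' = a'
  member v' = b'
  ≤ᵇ⇒ : ∀ {x y} → x ≤ᵇ y → x ≡ true → y ≡ true
  ≤ᵇ⇒ b≤b x≡true = x≡true
  ≤ᵇ⇒ f≤t _      = refl
  monotone : ∀ {x y} → x ≤P y → member x ≡ true → member y ≡ true
  monotone ≤P-refl x∈ = x∈
  monotone u≤u'    = ≤ᵇ⇒ a≤a'
  monotone u≤v'    = ≤ᵇ⇒ a≤b'
  monotone v≤u'    = ≤ᵇ⇒ b≤a'

-- p ↦ {v, u'}, q ↦ {u, u', v'}, r ↦ {u', v'}: the premise evaluates to P, the conclusion misses v.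
kleene∉K⁻ : ¬ Kleene K⁻
kleene∉K⁻ kleene = case kleene h (λ _ → tt) premise-whole v of λ ()
  where
  h : ℕ → Upset
  h zero          = upset false true  true false (f≤t , b≤b , b≤b)
  h (suc zero)    = upset true  false true true  (b≤b , b≤b , f≤t)
  h (suc (suc _)) = upset false false true true  (f≤t , f≤t , f≤t)
  premise-whole : ∀ χ → ｛ kleenePremise ｝ χ → IsWhole (evK h χ)
  premise-whole _ refl u  = refl
  premise-whole _ refl v  = refl
  premise-whole _ refl u' = refl
  premise-whole _ refl v' = refl

-- Compactness of K relative to disjunctions of gluts

gluts : ℕ → Fm
gluts zero    = ⊥ᶠ
gluts (suc N) = gluts N ∨ᶠ (var N ∧ᶠ ∼ᶠ var N)

gluts-designated : ∀ e N i → i < N → e i ≡ b₄ → Des₄ (evD e (gluts N))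
gluts-designated e (suc N) i i<1+N eᵢ=b with m<1+n⇒m<n∨m≡n i<1+N
... | inj₁ i<N  = designated-joinˡ _ _ (gluts-designated e N i i<N eᵢ=b)
... | inj₂ refl = designated-joinʳ _ _ (subst (λ x → Des₄ (meet₄ x (neg₄ x))) (sym eᵢ=b) (inj₁ refl))

counterexample : ExcludedMiddle 0ℓ → ∀ M {S Γ φ} → ¬ LogOn M S Γ φ →
  ∃ λ w → (∀ i → S (w i)) × (∀ γ → Γ γ → Matrix.D M (eval M w γ)) × ¬ Matrix.D M (eval M w φ)
counterexample em M ¬valid with ¬∀⇒∃¬ em ¬valid
... | w , ¬w with ¬→⇒×¬ em ¬w
... | w∈S , ¬w′ with ¬→⇒×¬ em ¬w′
... | Γ∈D , φ∉D = w , w∈S , Γ∈D , φ∉D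

_[_≔_] : {A : Set} → (ℕ → A) → ℕ → A → ℕ → A
(α [ m ≔ c ]) i with i ≟ m
... | yes _ = c
... | no  _ = α i

update-below : ∀ {A : Set} (α : ℕ → A) m c i → i < m → (α [ m ≔ c ]) i ≡ α i
update-below α m c i i<m with i ≟ m
... | yes refl = ⊥-elim (<-irrefl refl i<m)
... | no  _    = refl

update-agrees : ∀ {A : Set} (α e : ℕ → A) m → (∀ i → i < m → e i ≡ α i) →
                ∀ i → i < suc m → e i ≡ (α [ m ≔ e m ]) i
update-agrees α e m e≈α i i<1+m with i ≟ m
... | yes refl = refl
... | no  i≢m  = e≈α i (≤∧≢⇒< (s≤s⁻¹ i<1+m) i≢m)

module Compactness (em : ExcludedMiddle 0ℓ) {Δ : FmSet} {ψ : Fm}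
                   (unbounded : ∀ N → ¬ BD Δ (gluts N ∨ᶠ ψ)) where

  Refutes : (ℕ → DM4) → Set
  Refutes e = (∀ χ → Δ χ → Des₄ (evD e χ)) × ¬ Des₄ (evD e ψ)

  Approximates : ℕ → (ℕ → DM4) → ℕ → (ℕ → DM4) → Set
  Approximates m α N e = Refutes e × (∀ i → i < N → e i ≢ b₄) × (∀ i → i < m → e i ≡ α i)

  Extendable : ℕ → (ℕ → DM4) → Set
  Extendable m α = ∀ N → ∃ (Approximates m α N)

  start : ∀ α → Extendable 0 α
  start α N with counterexample em DM4-matrix {Γ = Δ} {φ = gluts N ∨ᶠ ψ} (unbounded N)
  ... | e , _ , Δ∈D , ¬glutsψ =
    e , (Δ∈D , ¬glutsψ ∘ designated-joinʳ _ _) ,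
    (λ i i<N eᵢ=b → ¬glutsψ (designated-joinˡ _ _ (gluts-designated e N i i<N eᵢ=b))) , λ _ ()

  max₄ : (DM4 → ℕ) → ℕ
  max₄ f = f ⊥₄ ⊔ℕ (f n₄ ⊔ℕ (f b₄ ⊔ℕ f ⊤₄))

  ≤max₄ : ∀ f c → f c ≤ max₄ f
  ≤max₄ f ⊥₄ = m≤m⊔n (f ⊥₄) _
  ≤max₄ f n₄ = m≤n⇒m≤o⊔n (f ⊥₄) (m≤m⊔n (f n₄) _)
  ≤max₄ f b₄ = m≤n⇒m≤o⊔n (f ⊥₄) (m≤n⇒m≤o⊔n (f n₄) (m≤m⊔n (f b₄) _))
  ≤max₄ f ⊤₄ = m≤n⇒m≤o⊔n (f ⊥₄) (m≤n⇒m≤o⊔n (f n₄) (m≤n⊔m (f b₄) _))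

  -- König's lemma: an approximation beyond the failure bounds of all four values at m
  -- would not fail for its own value at m.
  not-stuck : ∀ m α → Extendable m α →
              ¬ (∀ c → ∃ λ N → ¬ ∃ (Approximates (suc m) (α [ m ≔ c ]) N))
  not-stuck m α ext failure with ext (suc m ⊔ℕ max₄ (proj₁ ∘ failure))
  ... | e , refutes , glutFree , agrees =
    proj₂ (failure (e m)) (e , refutes , glutFree′ , update-agrees α e m agrees)
    where
    glutFree′ : ∀ i → i < proj₁ (failure (e m)) → e i ≢ b₄
    glutFree′ i i<N =
      glutFree i (<-≤-trans i<N (m≤n⇒m≤o⊔n (suc m) (≤max₄ (proj₁ ∘ failure) (e m))))

  extend : ∀ m α → Extendable m α → ∃ λ c → Extendable (suc m) (α [ m ≔ c ])
  extend m α ext with em {∃ λ c → Extendable (suc m) (α [ m ≔ c ])}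
  ... | yes extension = extension
  ... | no ¬extension = ⊥-elim (not-stuck m α ext λ c → ¬∀⇒∃¬ em λ ext′ → ¬extension (c , ext′))

  approximation : ∀ m → ∃ (Extendable m)
  approximation zero    = (λ _ → ⊥₄) , start (λ _ → ⊥₄)
  approximation (suc m) = next (approximation m)
    where
    next : ∃ (Extendable m) → ∃ (Extendable (suc m))
    next (α , ext) = α [ m ≔ proj₁ (extend m α ext) ] , proj₂ (extend m α ext)

  limit : ℕ → DM4
  limit i = proj₁ (approximation (suc i)) i

  approximation-stable : ∀ m i → i < m → proj₁ (approximation m) i ≡ limit i
  approximation-stable (suc m) i i<1+m with m<1+n⇒m<n∨m≡n i<1+m
  ... | inj₂ refl = refl
  ... | inj₁ i<m  = trans (update-below _ m _ i i<m) (approximation-stable m i i<m)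

  limit-glutFree : ∀ i → limit i ≢ b₄
  limit-glutFree i with proj₂ (approximation (suc i)) (suc i)
  ... | e , _ , glutFree , agrees = glutFree i ≤-refl ∘ trans (agrees i ≤-refl)

  -- Each formula only sees finitely many values of the limit.
  limit-local : ∀ χ → ∃ λ e → Refutes e × evD e χ ≡ evD limit χ
  limit-local χ with proj₂ (approximation (support χ)) 0
  ... | e , refutes , _ , agrees =
    e , refutes , eval-local DM4-matrix χ λ i i<χ →
                    trans (agrees i i<χ) (approximation-stable (support χ) i i<χ)

  ¬K : ¬ K Δ ψ
  ¬K K⊢ with limit-local ψ
  ... | e , (_ , ψ∉D) , eq = ψ∉D (subst Des₄ (sym eq) (K⊢ limit (λ i → ≢b⇒InK _ (limit-glutFree i)) Δ∈D))
    where
    Δ∈D : ∀ χ → Δ χ → Des₄ (evD limit χ)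
    Δ∈D χ χ∈Δ with limit-local χ
    ... | e , (Δ∈D , _) , eq = subst Des₄ eq (Δ∈D χ χ∈Δ)

K-compact : ExcludedMiddle 0ℓ → ∀ Δ ψ → K Δ ψ → ∃ λ N → BD Δ (gluts N ∨ᶠ ψ)
K-compact em Δ ψ K⊢ with em {∃ λ N → BD Δ (gluts N ∨ᶠ ψ)}
... | yes bounded = bounded
... | no ¬bounded = ⊥-elim (Compactness.¬K em {Δ} {ψ} (λ N BD⊢ → ¬bounded (N , BD⊢)) K⊢)

ExcludedMiddleBeside : Fm → FmSet
ExcludedMiddleBeside ψ χ = ∃ λ i → χ ≡ (var i ∨ᶠ ∼ᶠ var i) ∨ᶠ ψ

LP⇒BD : ∀ {Δ ψ} → LP Δ ψ → BD (Δ ∪ ExcludedMiddleBeside ψ) ψ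
LP⇒BD {Δ} {ψ} LP⊢ e _ designated with Des? (evD e ψ)
... | yes ψ∈D = ψ∈D
... | no  ψ∉D = ⊥-elim (ψ∉D (LP⊢ e inLP (λ χ χ∈Δ → designated χ (inj₁ χ∈Δ))))
  where
  inLP : ∀ i → InLP (e i)
  inLP i with join-designated _ _ (designated _ (inj₂ (i , refl)))
  ... | inj₁ excluded = ≢n⇒InLP (e i) (excludedMiddle⇒≢n (e i) excluded)
  ... | inj₂ ψ∈D = ⊥-elim (ψ∉D ψ∈D)

module Extension {L : RuleSet} (isL : IsLogic L) (BD≤L : BD ≤L L) where
  open IsLogic isL

  derive : ∀ {Γ Π φ} → L Γ φ → (∀ γ → Γ γ → L Π γ) → L Π φ
  derive Γ⊢φ Π⊢Γ = cut Π⊢Γ (monotonicity (λ _ → inj₂) Γ⊢φ)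

  ⊢-trans : ∀ {A B C} → L ｛ A ｝ B → L ｛ B ｝ C → L ｛ A ｝ C
  ⊢-trans A⊢B B⊢C = derive B⊢C λ { _ refl → A⊢B }

  BD⇒⊢ : ∀ {A B} → (∀ e → Des₄ (evD e A) → Des₄ (evD e B)) → L ｛ A ｝ B
  BD⇒⊢ {A} A⊨B = BD≤L _ _ λ e _ designated → A⊨B e (designated A refl)

  substitution-cut : ∀ {Γ φ Π ψ} τ → L Γ φ → (∀ γ → Γ γ → BD Π (sub τ γ)) →
                     BD (Π ∪ ｛ sub τ φ ｝) ψ → L Π ψ
  substitution-cut {Γ} {φ} {Π} τ Γ⊢φ Π⊢τΓ Π,τφ⊢ψ = cut Π⊢τφ (BD≤L _ _ Π,τφ⊢ψ)
    where
    Π⊢τφ : ∀ χ → ｛ sub τ φ ｝ χ → L Π χ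
    Π⊢τφ _ refl = derive (substitution τ Γ⊢φ)
                         λ { _ (γ , γ∈Γ , refl) → BD≤L _ _ (Π⊢τΓ γ γ∈Γ) }

  module Counterexample {Γ φ} (h : ℕ → Upset) (Γ⊢φ : L Γ φ) (Γ-whole : ∀ γ → Γ γ → IsWhole (evK h γ)) where

    kleene-from-missing-u : mem (evK h φ) u ≡ false → Kleene L
    kleene-from-missing-u u∉φ = substitution-cut τ Γ⊢φ premise⊢τΓ premise,τφ⊢conclusion
      where
      τ : ℕ → Fm
      τ = uTerm ∘ h
      premise⊢τΓ : ∀ γ → Γ γ → BD ｛ kleenePremise ｝ (sub τ γ)
      premise⊢τΓ γ γ∈Γ e _ _ =
        whole⇒designated u h τ e (λ i → uTerm-aboveₖ (h i) e) γ (Γ-whole γ γ∈Γ)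
      premise,τφ⊢conclusion : BD (｛ kleenePremise ｝ ∪ ｛ sub τ φ ｝) kleeneConclusion
      premise,τφ⊢conclusion e _ designated = kleeneConclusion-designated e (inj₁ λ r=n →
        missing⇒undesignated u h τ e (λ i → uTerm-exact (h i) e r=n) φ u∉φ
                             (designated _ (inj₂ refl)))

    kleene-from-missing-v : mem (evK h φ) v ≡ false → Kleene L
    kleene-from-missing-v v∉φ = substitution-cut τ Γ⊢φ premise⊢τΓ premise,τφ⊢conclusion
      where
      τ : ℕ → Fm
      τ = vTerm ∘ h
      premise⊢τΓ : ∀ γ → Γ γ → BD ｛ kleenePremise ｝ (sub τ γ)
      premise⊢τΓ γ γ∈Γ e _ designated with kleenePremise-designated e (designated _ refl)
      ... | inj₁ p=b =
        whole⇒designated v h τ e (λ i → vTerm-aboveₖ-πv (h i) e p=b) γ (Γ-whole γ γ∈Γ)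
      ... | inj₂ q∈D =
        whole⇒designated u h τ e (λ i → vTerm-aboveₖ-πu (h i) e q∈D) γ (Γ-whole γ γ∈Γ)
      premise,τφ⊢conclusion : BD (｛ kleenePremise ｝ ∪ ｛ sub τ φ ｝) kleeneConclusion
      premise,τφ⊢conclusion e _ designated with Des? (e 1)
      ... | yes q∈D = kleeneConclusion-designated e (inj₂ q∈D)
      ... | no q∉D with kleenePremise-designated e (designated _ (inj₁ refl))
      ...   | inj₂ q∈D = ⊥-elim (q∉D q∈D)
      ...   | inj₁ p=b = kleeneConclusion-designated e (inj₁ λ r=n →
        missing⇒undesignated v h τ e (λ i → vTerm-exact (h i) e p=b q∉D r=n) φ v∉φ
                             (designated _ (inj₂ refl)))

  ¬Kleene⇒≤K⁻ : ¬ Kleene L → L ≤L K⁻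
  ¬Kleene⇒≤K⁻ ¬kleene Γ φ Γ⊢φ h _ Γ-whole =
    whole-from-u-v (evK h φ) (member u kleene-from-missing-u) (member v kleene-from-missing-v)
    where
    open Counterexample h Γ⊢φ Γ-whole
    member : ∀ y → (mem (evK h φ) y ≡ false → Kleene L) → mem (evK h φ) y ≡ true
    member y missing⇒kleene with mem (evK h φ) y
    ... | true  = refl
    ... | false = ⊥-elim (¬kleene (missing⇒kleene refl))

  kleene-instance : Kleene L → ∀ a b c → L ｛ (a ∧ᶠ ∼ᶠ a) ∨ᶠ c ｝ ((b ∨ᶠ ∼ᶠ b) ∨ᶠ c)
  kleene-instance kleene a b c =
    monotonicity (λ { _ (_ , refl , refl) → refl }) (substitution σ kleene)
    where
    σ : ℕ → Fm
    σ zero          = a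
    σ (suc zero)    = c
    σ (suc (suc _)) = b

  -- Discharges the gluts one at a time, each by an instance of the Kleene rule.
  gluts⊢excludedMiddle : Kleene L → ∀ N b c → L ｛ gluts N ∨ᶠ c ｝ ((b ∨ᶠ ∼ᶠ b) ∨ᶠ c)
  gluts⊢excludedMiddle kleene zero    b c = BD⇒⊢ λ e → designated-joinʳ _ _
  gluts⊢excludedMiddle kleene (suc N) b c =
    ⊢-trans (BD⇒⊢ λ e → designated-join-rotate (evD e (gluts N)) _ (evD e c))
    (⊢-trans (kleene-instance kleene (var N) b (gluts N ∨ᶠ c))
    (⊢-trans (BD⇒⊢ λ e → designated-join-swap (evD e b∨∼b) (evD e (gluts N)) (evD e c))
    (⊢-trans (gluts⊢excludedMiddle kleene N b (b∨∼b ∨ᶠ c))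
             (BD⇒⊢ λ e → designated-join-contract (evD e b∨∼b) (evD e c)))))
    where
    b∨∼b = b ∨ᶠ ∼ᶠ b

  KO≤L : ExcludedMiddle 0ℓ → Kleene L → KO ≤L L
  KO≤L em kleene Δ ψ (LP⊢ , K⊢) = cut Δ⊢excludedMiddle (BD≤L _ _ (LP⇒BD LP⊢))
    where
    Δ⊢excludedMiddle : ∀ χ → ExcludedMiddleBeside ψ χ → L Δ χ
    Δ⊢excludedMiddle _ (i , refl) with K-compact em Δ ψ K⊢
    ... | N , Δ⊢gluts = derive (gluts⊢excludedMiddle kleene N (var i) ψ)
                               λ { _ refl → BD≤L _ _ Δ⊢gluts }

proposition6p11 : ExcludedMiddle (Level.suc 0ℓ) →
    (L : RuleSet) → IsLogic L → BD ≤L L → L ≤L CL →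
    (InInterval BD K⁻ L ⊎ InInterval KO CL L) ×
    ¬ (InInterval BD K⁻ L × InInterval KO CL L)
proposition6p11 em L isL BD≤L L≤CL = lies-in-one , not-both
  where
  open Extension isL BD≤L
  em₀ : ExcludedMiddle 0ℓ
  em₀ = lowerExcludedMiddle (Level.suc 0ℓ) em
  lies-in-one : InInterval BD K⁻ L ⊎ InInterval KO CL L
  lies-in-one with em₀ {Kleene L}
  ... | yes kleene = inj₂ (KO≤L em₀ kleene , L≤CL)
  ... | no ¬kleene = inj₁ (BD≤L , ¬Kleene⇒≤K⁻ ¬kleene)
  not-both : ¬ (InInterval BD K⁻ L × InInterval KO CL L)
  not-both ((_ , L≤K⁻) , (KO≤L′ , _)) = kleene∉K⁻ (L≤K⁻ _ _ (KO≤L′ ｛ kleenePremise ｝ kleeneConclusion kleene∈KO))
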